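{- Let $T$ be a finite rooted tree in which every inner node has at least two children, with leaf set $L$ and node set $V$. There exists a partition of $V\setminus L$ into four sets each of which is thin.
   Context: A set $X\subseteq V\setminus L$ of inner nodes is thin if for each $x\in X$ that is not the root, the parent of $x$ does not belong to $X$, and $x$ has at least one sibling (possibly a leaf) that does not belong to $X$. (Parts of the partition may be empty.) -}

module Defs where

open import Data.Nat using (ℕ; _≤_)
open import Data.Fin using (Fin)
open import Data.List using (List; []; _∷_; length; lookup)
open import Data.Product using (Σ; _×_; ∃)
open import Data.Sum using (_⊎_)
open import Relation.Nullary using (¬_)
open import Relation.Binary.PropositionalEquality using (_≡_)

data Tree : Set where
  node : List Tree → Tree

children : Tree → List Tree
children (node ts) = ts

-- Nodes of a tree, given as paths from the root.
data Pos : Tree → Set where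
  root  : ∀ {t} → Pos t
  child : ∀ {ts} (i : Fin (length ts)) → Pos (lookup ts i) → Pos (node ts)

subtree : (t : Tree) → Pos t → Tree
subtree t root = t
subtree (node ts) (child i p) = subtree (lookup ts i) p

deg : (t : Tree) → Pos t → ℕ
deg t p = length (children (subtree t p))

childOf : (t : Tree) (y : Pos t) → Fin (deg t y) → Pos t
childOf (node ts) root i = child i root
childOf (node ts) (child j p) i = child j (childOf (lookup ts j) p i)

Inner : (t : Tree) → Pos t → Set
Inner t p = 1 ≤ deg t p

FullTree : Tree → Set
FullTree t = (p : Pos t) → Inner t p → 2 ≤ deg t p

Thin : (t : Tree) → (Pos t → Set) → Set
Thin t X =
  ((x : Pos t) → X x → Inner t x) ×
  ((y : Pos t) (i : Fin (deg t y)) → X (childOf t y i) →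
     (¬ X y) × (Σ (Fin (deg t y)) λ j → (¬ j ≡ i) × (¬ X (childOf t y j))))

{-# OPTIONS --safe #-}
-- Colour the nodes top-down with colours in ℤ₂ × ℤ₂ (encoded as Fin 4): the root
-- gets any colour, the first child of a node of colour c gets c ⊕ 1 and every
-- other child gets c ⊕ 2. Then a node and its parent always differ in colour,
-- as do the first and second child of a node; in a full tree every inner node
-- has a second child, so each colour class is thin.
module Submission where

open import Defs
open import Data.Nat.Base using (_≤_; s≤s; >-nonZero⁻¹)
open import Data.Fin.Base using (Fin; suc)
open import Data.Fin.Patterns using (0F; 1F; 2F; 3F)
open import Data.Fin.Properties using (nonZeroIndex)
open import Data.List.Base using (lookup)
open import Data.Product.Base using (Σ; ∃; _×_; _,_; proj₁)
open import Function.Base using (_∘_)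
open import Relation.Nullary.Negation.Core using (¬_)
open import Relation.Binary.PropositionalEquality.Core using (_≡_; _≢_; refl; sym; trans)

module _ {C : Set} where

  paint : (∀ {n} → C → Fin n → C) → (t : Tree) → C → Pos t → C
  paint rule t c root = c
  paint rule (node ts) c (child i p) = paint rule (lookup ts i) (rule c i) p

  paint-childOf : (rule : ∀ {n} → C → Fin n → C) (t : Tree) (c : C)
                  (y : Pos t) (i : Fin (deg t y)) →
                  paint rule t c (childOf t y i) ≡ rule (paint rule t c y) i
  paint-childOf rule (node ts) c root i = refl
  paint-childOf rule (node ts) c (child j p) i =
    paint-childOf rule (lookup ts j) (rule c j) p i

  colourClass-thin : (t : Tree) (f : Pos t → C) →
    ((y : Pos t) (i : Fin (deg t y)) → f (childOf t y i) ≢ f y) →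
    ((y : Pos t) (i : Fin (deg t y)) →
       ∃ λ j → j ≢ i × f (childOf t y j) ≢ f (childOf t y i)) →
    (k : C) → Thin t (λ x → Inner t x × f x ≡ k)
  colourClass-thin t f parent≢ sibling≢ k = (λ x → proj₁) , classFree
    where
    classFree : (y : Pos t) (i : Fin (deg t y)) → Inner t (childOf t y i) × f (childOf t y i) ≡ k →
                ¬ (Inner t y × f y ≡ k) ×
                Σ (Fin (deg t y)) λ j → j ≢ i × ¬ (Inner t (childOf t y j) × f (childOf t y j) ≡ k)
    classFree y i (_ , fx≡k) =
      (λ (_ , fy≡k) → parent≢ y i (trans fx≡k (sym fy≡k))) ,
      (let (j , j≢i , fj≢fx) = sibling≢ y i in
       j , j≢i , λ (_ , fj≡k) → fj≢fx (trans fj≡k (sym fx≡k)))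

_⊕1 _⊕2 : Fin 4 → Fin 4
0F ⊕1 = 1F
1F ⊕1 = 0F
2F ⊕1 = 3F
3F ⊕1 = 2F
0F ⊕2 = 2F
1F ⊕2 = 3F
2F ⊕2 = 0F
3F ⊕2 = 1F

childColour : ∀ {n} → Fin 4 → Fin n → Fin 4
childColour c 0F = c ⊕1
childColour c (suc _) = c ⊕2

⊕1≢⊕2 : (c : Fin 4) → c ⊕1 ≢ c ⊕2
⊕1≢⊕2 0F ()
⊕1≢⊕2 1F ()
⊕1≢⊕2 2F ()
⊕1≢⊕2 3F ()

childColour-≢ : ∀ {n} (c : Fin 4) (i : Fin n) → childColour c i ≢ c
childColour-≢ 0F 0F ()
childColour-≢ 1F 0F ()
childColour-≢ 2F 0F ()
childColour-≢ 3F 0F ()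
childColour-≢ 0F (suc _) ()
childColour-≢ 1F (suc _) ()
childColour-≢ 2F (suc _) ()
childColour-≢ 3F (suc _) ()

childColour-sibling : ∀ {n} → 2 ≤ n → (c : Fin 4) (i : Fin n) →
                      ∃ λ j → j ≢ i × childColour c j ≢ childColour c i
childColour-sibling (s≤s (s≤s _)) c 0F = 1F , (λ ()) , ⊕1≢⊕2 c ∘ sym
childColour-sibling (s≤s (s≤s _)) c (suc _) = 0F , (λ ()) , ⊕1≢⊕2 c

lemma3p9 : (t : Tree) → FullTree t →
    Σ (Pos t → Fin 4) λ f →
      (k : Fin 4) → Thin t (λ x → Inner t x × f x ≡ k)
lemma3p9 t full = colour , colourClass-thin t colour parent≢ sibling≢
  where
  colour : Pos t → Fin 4
  colour = paint childColour t 0F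

  colour-childOf : (y : Pos t) (i : Fin (deg t y)) → colour (childOf t y i) ≡ childColour (colour y) i
  colour-childOf = paint-childOf childColour t 0F

  parent≢ : (y : Pos t) (i : Fin (deg t y)) → colour (childOf t y i) ≢ colour y
  parent≢ y i = childColour-≢ (colour y) i ∘ trans (sym (colour-childOf y i))

  sibling≢ : (y : Pos t) (i : Fin (deg t y)) →
             ∃ λ j → j ≢ i × colour (childOf t y j) ≢ colour (childOf t y i)
  sibling≢ y i =
    let (j , j≢i , childColours≢) = childColour-sibling (full y (>-nonZero⁻¹ _ {{nonZeroIndex i}})) (colour y) i
    in j , j≢i , λ e → childColours≢ (trans (sym (colour-childOf y j)) (trans e (colour-childOf y i)))
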